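{- Let $1\le k<n$ and $I,J\in V_{k,n}$ with corresponding order filters $F_I,F_J$ of $P_{k,n}$. Let $P_1,\dots,P_d$ be the connected components of the symmetric difference $F_I\triangle F_J$, labelled so that for $i<j$ every $(a,b)\in P_i$ and $(a',b')\in P_j$ satisfy $a\le a'$ and $b\le b'$. Let $\alpha_I,\alpha_J\in\{0,1\}^d$ be defined by $\chi_I=\chi_{F_I\cap F_J}+\sum_i(\alpha_I)_i\chi_{P_i}$ and similarly for $J$. Then (1) $I$ and $J$ are nonnesting if and only if $\{\alpha_I,\alpha_J\}=\{(0,\dots,0),(1,\dots,1)\}$; (2) $I$ and $J$ are noncrossing if and only if $\{\alpha_I,\alpha_J\}=\{(0,1,0,1,\dots),(1,0,1,0,\dots)\}$.
   Context: $V_{k,n}$ is the set of strictly increasing vectors $(i_1,\dots,i_k)$ with entries in $[n]$. $P_{k,n}=[k]\times[n-k]$ with $(a,b)\le(a',b')$ iff $a\ge a'$ and $b\le b'$ (row $a=1$ is the top row). To $I$ corresponds the order filter $F_I=\{(a,b): i_a\le a+b-1\}$ and its characteristic vector $\chi_I\in\{0,1\}^{P_{k,n}}$; this is a bijection between $V_{k,n}$ and filters of $P_{k,n}$. Components of a subset are the connected components of its comparability graph in $P_{k,n}$. The minimal face of the order polytope $\mathrm{conv}\{\chi_I\}$ containing $\chi_I,\chi_J$ is a combinatorial $d$-cube with vertices $\chi_{F_I\cap F_J}+\sum_i\alpha_i\chi_{P_i}$, $\alpha\in\{0,1\}^d$. Arcs $(p<p')$, $(q<q')$ nest if $p<q<q'<p'$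 or $q<p<p'<q'$, and cross if $p<q<p'<q'$ or $q<p<q'<p'$. $I,J$ are nonnesting if for all $a<b$ the arcs $(i_a<i_b)$, $(j_a<j_b)$ do not nest; noncrossing if for all $a<b$ with $i_\ell=j_\ell$ for all $a<\ell<b$ these arcs do not cross. -}

module Defs where

open import Data.Nat using (ℕ; zero; suc; _+_; _*_; _∸_; _≤_; _<_; _≤ᵇ_)
open import Data.Bool using (Bool; true; false; _∧_; _xor_; not)
open import Data.Fin using (Fin; toℕ) renaming (zero to fzero; suc to fsuc)
open import Data.Product using (Σ; ∃; _×_; _,_)
open import Data.Sum using (_⊎_)
open import Relation.Nullary using (¬_)
open import Relation.Binary.PropositionalEquality using (_≡_; _≢_)
open import Function.Bundles using (_⇔_)

-- Indices: a row index a : Fin k stands for the row a+1 ∈ [k];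
-- a column index b : Fin m stands for the column b+1 ∈ [m]  (m = n - k).

-- V_{k,n}: strictly increasing vectors (i_1,…,i_k) with entries in [n] = {1,…,n}.
-- Entry i_{a+1} is I a.
IsIncVec : (k n : ℕ) → (Fin k → ℕ) → Set
IsIncVec k n I =
  (∀ a → 1 ≤ I a × I a ≤ n) × (∀ a b → toℕ a < toℕ b → I a < I b)

V : ℕ → ℕ → Set
V k n = Σ (Fin k → ℕ) (IsIncVec k n)

vec : ∀ {k n} → V k n → Fin k → ℕ
vec (I , _) = I

Cell : ℕ → ℕ → Set
Cell k n = Fin k × Fin (n ∸ k)

_≤P_ : ∀ {k n} → Cell k n → Cell k n → Set
(a , b) ≤P (a' , b') = toℕ a' ≤ toℕ a × toℕ b ≤ toℕ b'

Comparable : ∀ {k n} → Cell k n → Cell k n → Set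
Comparable p q = p ≤P q ⊎ q ≤P p

Subset : ℕ → ℕ → Set
Subset k n = Cell k n → Bool

-- The order filter F_I = {(a,b) : i_a ≤ a + b - 1} (1-indexed a,b).
-- With 0-indexed a,b this reads I a ≤ (a+1) + (b+1) - 1 = a + b + 1.
F : ∀ {k n} → V k n → Subset k n
F I (a , b) = vec I a ≤ᵇ (toℕ a + toℕ b + 1)

_∩_ : ∀ {k n} → Subset k n → Subset k n → Subset k n
(S ∩ T) p = S p ∧ T p

_△_ : ∀ {k n} → Subset k n → Subset k n → Subset k n
(S △ T) p = S p xor T p

bit : Bool → ℕ
bit false = 0
bit true  = 1

sumFin : ∀ d → (Fin d → ℕ) → ℕ
sumFin zero    f = 0
sumFin (suc d) f = f fzero + sumFin d (λ i → f (fsuc i))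

data Path {k n} (S : Subset k n) : Cell k n → Cell k n → Set where
  here  : ∀ {p} → S p ≡ true → Path S p p
  step  : ∀ {p r q} → S p ≡ true → Comparable p r → Path S r q → Path S p q

-- P : Fin d → Subset is the list of connected components of S
-- (components of the comparability graph of P_{k,n} induced on S):
-- nonempty, pairwise disjoint, covering S exactly, each connected,
-- and no comparabilities between different pieces.
IsComponents : ∀ {k n} → Subset k n → (d : ℕ) → (Fin d → Subset k n) → Set
IsComponents S d P =
    (∀ i → ∃ λ p → P i p ≡ true)
  × (∀ p → (S p ≡ true) ⇔ (∃ λ i → P i p ≡ true))
  × (∀ i j p → P i p ≡ true → P j p ≡ true → i ≡ j)
  × (∀ i p q → P i p ≡ true → P i q ≡ true → Path (P i) p q)
  × (∀ i j p q → i ≢ j → P i p ≡ true → P j q ≡ true → ¬ Comparable p q)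

IsLabelled : ∀ {k n} d → (Fin d → Subset k n) → Set
IsLabelled d P = ∀ i j a b a' b' → toℕ i < toℕ j →
  P i (a , b) ≡ true → P j (a' , b') ≡ true → toℕ a ≤ toℕ a' × toℕ b ≤ toℕ b'

Decomposes : ∀ {k n} → (I J K : V k n) → ∀ d → (Fin d → Subset k n) → (Fin d → Bool) → Set
Decomposes I J K d P α = ∀ p →
  bit (F K p) ≡ bit ((F I ∩ F J) p) + sumFin d (λ i → bit (α i) * bit (P i p))

Nest : ℕ → ℕ → ℕ → ℕ → Set
Nest p p' q q' = (p < q × q < q' × q' < p') ⊎ (q < p × p < p' × p' < q')

Cross : ℕ → ℕ → ℕ → ℕ → Set
Cross p p' q q' = (p < q × q < p' × p' < q') ⊎ (q < p × p < q' × q' < p')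

Nonnesting : ∀ {k n} → V k n → V k n → Set
Nonnesting I J = ∀ a b → toℕ a < toℕ b →
  ¬ Nest (vec I a) (vec I b) (vec J a) (vec J b)

Noncrossing : ∀ {k n} → V k n → V k n → Set
Noncrossing I J = ∀ a b → toℕ a < toℕ b →
  (∀ l → toℕ a < toℕ l → toℕ l < toℕ b → vec I l ≡ vec J l) →
  ¬ Cross (vec I a) (vec I b) (vec J a) (vec J b)

IsConst : ∀ {d} → Bool → (Fin d → Bool) → Set
IsConst c α = ∀ i → α i ≡ c

odd : ℕ → Bool
odd zero    = false
odd (suc m) = not (odd m)

-- (0,1,0,1,…): entry at 1-indexed position i+1 is 1 iff i+1 is even, i.e. i odd.
-- (1,0,1,0,…) is its complement.
IsAlt01 : ∀ {d} → (Fin d → Bool) → Set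
IsAlt01 α = ∀ i → α i ≡ odd (toℕ i)

IsAlt10 : ∀ {d} → (Fin d → Bool) → Set
IsAlt10 α = ∀ i → α i ≡ not (odd (toℕ i))

PairIsConst : ∀ {d} → (Fin d → Bool) → (Fin d → Bool) → Set
PairIsConst α β = (IsConst false α × IsConst true β) ⊎ (IsConst true α × IsConst false β)

PairIsAlt : ∀ {d} → (Fin d → Bool) → (Fin d → Bool) → Set
PairIsAlt α β = (IsAlt01 α × IsAlt10 β) ⊎ (IsAlt10 α × IsAlt01 β)

module Submission where

-- Row x of P_{k,n} meets F_X exactly in the columns c with X_x ≤ x + c + 1; hence row x
-- meets F_A \ F_B iff A_x < B_x, and misses F_A △ F_B iff A_x = B_x.  Evaluating the
-- decomposition on P_i shows that (α_K)_i is the value of χ_K on P_i; so P_i ⊆ F_I \ F_J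
-- when (α_I)_i = 1, P_i ⊆ F_J \ F_I when (α_I)_i = 0, and α_J = not α_I.
--
-- (1) All α_I vanish iff I_x ≥ J_x in every row, and symmetrically for α_J.  So
--     {α_I, α_J} = {0…0, 1…1} iff one vector dominates the other, iff no nesting.
-- (2) Two adjacent components P_x, P_{x+1} have the same colour iff there is a crossing
--     A_a < B_a < A_b < B_b ({A,B} = {I,J}) with A, B agreeing strictly between rows a, b.
--     Given the crossing, cells of F_A △ F_B in rows ≤ a are incomparable to those in
--     rows ≥ b, so rows a and b lie in different components with none in between.
--     Conversely, take the last row a of P_x and the first row b of P_{x+1}: the rows in
--     between agree, and B_a ≥ A_b would make the two components touch.  A 0/1-vector
--     whose adjacent entries all differ is (0,1,0,…) or (1,0,1,…).

open import Defs
open import Data.Bool using (Bool; true; false; not; _∧_; _xor_)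
import Data.Bool.Properties as Bool
open import Data.Empty using (⊥; ⊥-elim)
open import Data.Fin using (Fin; toℕ; fromℕ; fromℕ<; inject₁) renaming (zero to fzero; suc to fsuc)
import Data.Fin.Properties as Fin
open import Data.Nat using (ℕ; zero; suc; _+_; _*_; _∸_; _≤_; _<_; _≤ᵇ_; z≤n; s≤s; s≤s⁻¹; _≤?_; _<?_)
open import Data.Nat.Properties
open import Data.Nat.Tactic.RingSolver using (solve-∀)
open import Data.Product using (Σ; ∃; ∃₂; _×_; _,_; proj₁; proj₂)
open import Data.Sum using (_⊎_; inj₁; inj₂)
open import Data.Sum.Function.Propositional using (_⊎-⇔_)
open import Function using (_∘_)
open import Function.Bundles using (_⇔_; Equivalence; mk⇔)
open import Function.Construct.Symmetry using (⇔-sym)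
import Function.Properties.Equivalence as ⇔
open import Relation.Binary.Definitions using (tri<; tri≈; tri>)
open import Relation.Binary.PropositionalEquality
open import Relation.Nullary using (¬_; yes; no; contradiction)
open import Relation.Unary using (Decidable)

open Equivalence using (to; from)

true≢false : true ≢ false
true≢false ()

xor-true : ∀ {a b} → a xor b ≡ true → (a ≡ true × b ≡ false) ⊎ (a ≡ false × b ≡ true)
xor-true {true}  {false} _ = inj₁ (refl , refl)
xor-true {false} {true}  _ = inj₂ (refl , refl)
xor-true {true}  {true}  ()
xor-true {false} {false} ()

xor-true⇒∧-false : ∀ {a b} → a xor b ≡ true → a ∧ b ≡ false
xor-true⇒∧-false {true}  {false} _ = refl
xor-true⇒∧-false {false} {true}  _ = refl
xor-true⇒∧-false {true}  {true}  ()
xor-true⇒∧-false {false} {false} ()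

xor-true⇒≡not : ∀ {a b} → a xor b ≡ true → b ≡ not a
xor-true⇒≡not {true}  {false} _ = refl
xor-true⇒≡not {false} {true}  _ = refl
xor-true⇒≡not {true}  {true}  ()
xor-true⇒≡not {false} {false} ()

bit-injective : ∀ {a b} → bit a ≡ bit b → a ≡ b
bit-injective {true}  {true}  _ = refl
bit-injective {false} {false} _ = refl
bit-injective {true}  {false} ()
bit-injective {false} {true}  ()

sumFin-zero : ∀ d (f : Fin d → ℕ) → (∀ j → f j ≡ 0) → sumFin d f ≡ 0
sumFin-zero zero    f zero-everywhere = refl
sumFin-zero (suc d) f zero-everywhere =
  cong₂ _+_ (zero-everywhere fzero) (sumFin-zero d (f ∘ fsuc) (zero-everywhere ∘ fsuc))

sumFin-single : ∀ {d} (f : Fin d → ℕ) i → (∀ j → j ≢ i → f j ≡ 0) → sumFin d f ≡ f i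
sumFin-single {suc d} f fzero others = begin
  f fzero + sumFin d (f ∘ fsuc) ≡⟨ cong (f fzero +_) (sumFin-zero d _ (λ j → others (fsuc j) λ ())) ⟩
  f fzero + 0                   ≡⟨ +-identityʳ _ ⟩
  f fzero                       ∎
  where open ≡-Reasoning
sumFin-single {suc d} f (fsuc i) others =
  cong₂ _+_ (others fzero λ ())
            (sumFin-single (f ∘ fsuc) i (λ j j≢i → others (fsuc j) (j≢i ∘ Fin.suc-injective)))

Increasing : ∀ {k} → (Fin k → ℕ) → Set
Increasing f = ∀ a b → toℕ a < toℕ b → f a < f b

increasing-steps : ∀ {k} {f : Fin k → ℕ} → Increasing f →
  ∀ e x y → toℕ y ≡ toℕ x + e → f x + e ≤ f y
increasing-steps {f = f} inc zero x y y≡x+0 =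
  ≤-reflexive (trans (+-identityʳ _) (cong f (Fin.toℕ-injective (sym (trans y≡x+0 (+-identityʳ _))))))
increasing-steps inc (suc e) x fzero y≡x+1+e = contradiction (trans y≡x+1+e (+-suc _ e)) λ ()
increasing-steps {f = f} inc (suc e) x (fsuc y) y≡x+1+e = begin
  f x + suc e          ≡⟨ +-suc (f x) e ⟩
  suc (f x + e)        ≤⟨ s≤s (increasing-steps inc e x (inject₁ y) (trans (Fin.toℕ-inject₁ y) y≡x+e)) ⟩
  suc (f (inject₁ y))  ≤⟨ inc (inject₁ y) (fsuc y) (s≤s (≤-reflexive (Fin.toℕ-inject₁ y))) ⟩
  f (fsuc y)           ∎
  where
    open ≤-Reasoning
    y≡x+e : toℕ y ≡ toℕ x + e
    y≡x+e = suc-injective (trans y≡x+1+e (+-suc _ e))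

increasing-spread : ∀ {k} {f : Fin k → ℕ} → Increasing f →
  ∀ {x y} → toℕ x ≤ toℕ y → f x + toℕ y ≤ f y + toℕ x
increasing-spread {f = f} inc {x} {y} x≤y = begin
  f x + toℕ y                        ≡⟨ cong (f x +_) (sym (m∸n+n≡m x≤y)) ⟩
  f x + (toℕ y ∸ toℕ x + toℕ x)      ≡⟨ sym (+-assoc (f x) _ _) ⟩
  f x + (toℕ y ∸ toℕ x) + toℕ x      ≤⟨ +-monoˡ-≤ (toℕ x) (increasing-steps inc _ x y (sym (m+[n∸m]≡n x≤y))) ⟩
  f y + toℕ x                        ∎
  where open ≤-Reasoning

increasing : ∀ {k n} (X : V k n) → Increasing (vec X)
increasing X = proj₂ (proj₂ X)

entry-lower : ∀ {k n} (X : V k n) x → suc (toℕ x) ≤ vec X x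
entry-lower {suc k} X x = begin
  1 + toℕ x               ≤⟨ +-monoˡ-≤ (toℕ x) (proj₁ (proj₁ (proj₂ X) fzero)) ⟩
  vec X fzero + toℕ x     ≤⟨ increasing-spread (increasing X) z≤n ⟩
  vec X x + 0             ≡⟨ +-identityʳ _ ⟩
  vec X x                 ∎
  where open ≤-Reasoning

entry-upper : ∀ {k n} (X : V k n) x → vec X x + k ≤ n + suc (toℕ x)
entry-upper {suc k} {n} X x = begin
  vec X x + suc k              ≡⟨ +-suc _ k ⟩
  suc (vec X x + k)            ≡⟨ cong (λ m → suc (vec X x + m)) (sym (Fin.toℕ-fromℕ k)) ⟩
  suc (vec X x + toℕ (fromℕ k)) ≤⟨ s≤s (increasing-spread (increasing X) x≤last) ⟩
  suc (vec X (fromℕ k) + toℕ x) ≤⟨ s≤s (+-monoˡ-≤ (toℕ x) (proj₂ (proj₁ (proj₂ X) (fromℕ k)))) ⟩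
  suc (n + toℕ x)              ≡⟨ sym (+-suc n _) ⟩
  n + suc (toℕ x)              ∎
  where
    open ≤-Reasoning
    x≤last : toℕ x ≤ toℕ (fromℕ k)
    x≤last = subst (toℕ x ≤_) (sym (Fin.toℕ-fromℕ k)) (s≤s⁻¹ (Fin.toℕ<n x))

-- I and J nest iff some row has I_a < J_a and another J_b < I_b.
Dominated : ∀ {k n} → V k n → V k n → Set
Dominated A B = ∀ x → ¬ vec A x < vec B x

nonnesting⇔ordered : ∀ {k n} (I J : V k n) → Nonnesting I J ⇔ (Dominated I J ⊎ Dominated J I)
nonnesting⇔ordered I J = mk⇔ ordered nonnesting
  where
    nonnesting : Dominated I J ⊎ Dominated J I → Nonnesting I J
    nonnesting (inj₁ dom) a b _ (inj₁ (Ia<Ja , _ , _)) = dom a Ia<Ja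
    nonnesting (inj₁ dom) a b _ (inj₂ (_ , _ , Ib<Jb)) = dom b Ib<Jb
    nonnesting (inj₂ dom) a b _ (inj₁ (_ , _ , Jb<Ib)) = dom b Jb<Ib
    nonnesting (inj₂ dom) a b _ (inj₂ (Ja<Ia , _ , _)) = dom a Ja<Ia

    ordered : Nonnesting I J → Dominated I J ⊎ Dominated J I
    ordered nn with Fin.any? (λ x → vec J x <? vec I x)
    ... | no none = inj₂ (λ x Jx<Ix → none (x , Jx<Ix))
    ... | yes (x₀ , J<I) = inj₁ dominated
      where
        dominated : Dominated I J
        dominated y I<J with <-cmp (toℕ y) (toℕ x₀)
        ... | tri< y<x₀ _ _ = nn y x₀ y<x₀ (inj₁ (I<J , increasing J y x₀ y<x₀ , J<I))
        ... | tri> _ _ x₀<y = nn x₀ y x₀<y (inj₂ (J<I , increasing I x₀ y x₀<y , I<J))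
        ... | tri≈ _ y≡x₀ _ =
          <-asym I<J (subst (λ z → vec J z < vec I z) (sym (Fin.toℕ-injective y≡x₀)) J<I)

threshold : ∀ {k n} → Cell k n → ℕ
threshold (a , b) = toℕ a + toℕ b + 1

∈F⇔ : ∀ {k n} (X : V k n) {x c} → F X (x , c) ≡ true ⇔ vec X x ≤ threshold (x , c)
∈F⇔ X = mk⇔ (λ e → ≤ᵇ⇒≤ _ _ (from Bool.T-≡ e)) (λ le → to Bool.T-≡ (≤⇒≤ᵇ le))

∉F⇔ : ∀ {k n} (X : V k n) {x c} → F X (x , c) ≡ false ⇔ threshold (x , c) < vec X x
∉F⇔ X = mk⇔ (λ e → ≰⇒> λ le → true≢false (trans (sym (from (∈F⇔ X) le)) e))
            (λ gt → Bool.¬-not λ e → <⇒≱ gt (to (∈F⇔ X) e))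

F-up : ∀ {k n} (X : V k n) {p q : Cell k n} → p ≤P q → F X p ≡ true → F X q ≡ true
F-up X {a , b} {a' , b'} (a'≤a , b≤b') e = from (∈F⇔ X) (+-cancelˡ-≤ (toℕ a) _ _ (begin
  toℕ a + vec X a'              ≡⟨ +-comm (toℕ a) _ ⟩
  vec X a' + toℕ a              ≤⟨ increasing-spread (increasing X) a'≤a ⟩
  vec X a + toℕ a'              ≤⟨ +-monoˡ-≤ (toℕ a') (to (∈F⇔ X) e) ⟩
  toℕ a + toℕ b + 1 + toℕ a'    ≤⟨ +-monoˡ-≤ (toℕ a') (+-monoˡ-≤ 1 (+-monoʳ-≤ (toℕ a) b≤b')) ⟩
  toℕ a + toℕ b' + 1 + toℕ a'   ≡⟨ rearrange (toℕ a) (toℕ a') (toℕ b') ⟩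
  toℕ a + (toℕ a' + toℕ b' + 1) ∎))
  where
    open ≤-Reasoning
    rearrange : ∀ a a' b' → a + b' + 1 + a' ≡ a + (a' + b' + 1)
    rearrange = solve-∀

F-down : ∀ {k n} (X : V k n) {p q : Cell k n} → p ≤P q → F X q ≡ false → F X p ≡ false
F-down X p≤q q∉F = Bool.¬-not λ p∈F → true≢false (trans (sym (F-up X p≤q p∈F)) q∉F)

F-antitone : ∀ {k n} (X Y : V k n) {x c} → vec Y x ≤ vec X x → F X (x , c) ≡ true → F Y (x , c) ≡ true
F-antitone X Y Y≤X e = from (∈F⇔ Y) (≤-trans Y≤X (to (∈F⇔ X) e))

F-antitone-false : ∀ {k n} (X Y : V k n) {x c} → vec X x ≤ vec Y x → F X (x , c) ≡ false → F Y (x , c) ≡ false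
F-antitone-false X Y X≤Y e = from (∉F⇔ Y) (<-≤-trans (to (∉F⇔ X) e) X≤Y)

agree⇒F≡ : ∀ {k n} (A B : V k n) {l c} → vec A l ≡ vec B l → F A (l , c) ≡ F B (l , c)
agree⇒F≡ A B {l} {c} eq = cong (λ v → v ≤ᵇ threshold (l , c)) eq

Diff : ∀ {k n} → V k n → V k n → Cell k n → Set
Diff A B p = F A p ≡ true × F B p ≡ false

△⇔Diff : ∀ {k n} (A B : V k n) {p} → (F A △ F B) p ≡ true ⇔ (Diff A B p ⊎ Diff B A p)
△⇔Diff A B {p} = mk⇔ split join
  where
    split : (F A △ F B) p ≡ true → Diff A B p ⊎ Diff B A p
    split e with xor-true e
    ... | inj₁ (inA , outB) = inj₁ (inA , outB)
    ... | inj₂ (outA , inB) = inj₂ (inB , outA)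
    join : Diff A B p ⊎ Diff B A p → (F A △ F B) p ≡ true
    join (inj₁ (inA , outB)) rewrite inA | outB = refl
    join (inj₂ (inB , outA)) rewrite inB | outA = refl

Diff⇒row< : ∀ {k n} (A B : V k n) {x c} → Diff A B (x , c) → vec A x < vec B x
Diff⇒row< A B (inA , outB) = ≤-<-trans (to (∈F⇔ A) inA) (to (∉F⇔ B) outB)

-- If A_x < B_x, the leftmost cell of row x in F_A (threshold exactly A_x) lies in F_A \ F_B.
row<⇒Diff : ∀ {k n} (A B : V k n) x → vec A x < vec B x →
  Σ (Fin (n ∸ k)) λ c → threshold (x , c) ≡ vec A x × Diff A B (x , c)
row<⇒Diff {k} {n} A B x A<B = c , on-entry , from (∈F⇔ A) (≤-reflexive (sym on-entry))
                                          , from (∉F⇔ B) (subst (_< vec B x) (sym on-entry) A<B)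
  where
    open ≤-Reasoning
    swap-last : ∀ a b c → a + b + c ≡ a + c + b
    swap-last = solve-∀
    c₀ : ℕ
    c₀ = vec A x ∸ suc (toℕ x)
    c₀-spec : c₀ + suc (toℕ x) ≡ vec A x
    c₀-spec = m∸n+n≡m (entry-lower A x)
    c₀<m : c₀ < n ∸ k
    c₀<m = m+n≤o⇒m≤o∸n (suc c₀) (+-cancelʳ-< (suc (toℕ x)) (c₀ + k) n (begin-strict
      c₀ + k + suc (toℕ x)   ≡⟨ swap-last c₀ k _ ⟩
      c₀ + suc (toℕ x) + k   ≡⟨ cong (_+ k) c₀-spec ⟩
      vec A x + k            <⟨ +-monoˡ-< k A<B ⟩
      vec B x + k            ≤⟨ entry-upper B x ⟩
      n + suc (toℕ x)        ∎))
    c : Fin (n ∸ k)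
    c = fromℕ< c₀<m
    on-entry : threshold (x , c) ≡ vec A x
    on-entry = begin-equality
      toℕ x + toℕ c + 1   ≡⟨ cong (λ m → toℕ x + m + 1) (Fin.toℕ-fromℕ< c₀<m) ⟩
      toℕ x + c₀ + 1      ≡⟨ rearrange (toℕ x) c₀ ⟩
      c₀ + suc (toℕ x)    ≡⟨ c₀-spec ⟩
      vec A x             ∎
      where rearrange : ∀ x c → x + c + 1 ≡ c + suc x
            rearrange = solve-∀

row-empty⇒agree : ∀ {k n} (A B : V k n) l → (∀ c → (F A △ F B) (l , c) ≢ true) → vec A l ≡ vec B l
row-empty⇒agree A B l empty with <-cmp (vec A l) (vec B l)
... | tri≈ _ A≡B _ = A≡B
... | tri< A<B _ _ = let (c , _ , diff) = row<⇒Diff A B l A<B in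
                     ⊥-elim (empty c (from (△⇔Diff A B) (inj₁ diff)))
... | tri> _ _ B<A = let (c , _ , diff) = row<⇒Diff B A l B<A in
                     ⊥-elim (empty c (from (△⇔Diff A B) (inj₂ diff)))

agree⇒row-empty : ∀ {k n} (A B : V k n) {l c} → vec A l ≡ vec B l → (F A △ F B) (l , c) ≢ true
agree⇒row-empty A B {l} {c} A≡B e with to (△⇔Diff A B) e
... | inj₁ (inA , outB) = true≢false (trans (sym inA) (trans (agree⇒F≡ A B A≡B) outB))
... | inj₂ (inB , outA) = true≢false (trans (sym inB) (trans (sym (agree⇒F≡ A B A≡B)) outA))

Interleaved : ∀ {k n} → V k n → V k n → Fin k → Fin k → Set
Interleaved A B a b = vec A a < vec B a × vec B a < vec A b × vec A b < vec B b

Agree : ∀ {k n} → V k n → V k n → Fin k → Fin k → Set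
Agree A B a b = ∀ l → toℕ a < toℕ l → toℕ l < toℕ b → vec A l ≡ vec B l

Adjacent : ∀ {d} → Fin d → Fin d → Set
Adjacent x y = toℕ y ≡ suc (toℕ x)

adjacent⇒< : ∀ {d} {x y : Fin d} → Adjacent x y → toℕ x < toℕ y
adjacent⇒< adj = ≤-reflexive (sym adj)

adjacent⇒≢ : ∀ {d} {x y : Fin d} → Adjacent x y → x ≢ y
adjacent⇒≢ adj refl = <-irrefl refl (adjacent⇒< adj)

adjacent-or-between : ∀ {d} {x y : Fin d} → toℕ x < toℕ y →
  Adjacent x y ⊎ Σ (Fin d) λ z → toℕ x < toℕ z × toℕ z < toℕ y
adjacent-or-between {x = x} {y} x<y with m≤n⇒m<n∨m≡n x<y
... | inj₂ 1+x≡y = inj₁ (sym 1+x≡y)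
... | inj₁ 1+x<y = inj₂ (z , ≤-reflexive (sym z≡1+x) , subst (_< toℕ y) (sym z≡1+x) 1+x<y)
  where
    z = fromℕ< (<-trans 1+x<y (Fin.toℕ<n y))
    z≡1+x : toℕ z ≡ suc (toℕ x)
    z≡1+x = Fin.toℕ-fromℕ< _

-- In a crossing of rows a < b agreeing in between, no column c has (a,c) ∉ F_B and
-- (b,c) ∈ F_A: for b = a+1 this contradicts B_a < A_b, otherwise row a+1 would lie
-- inside F_A but outside F_B although A and B agree on it.
crossing-columns : ∀ {k n} (A B : V k n) {a b} → toℕ a < toℕ b → Agree A B a b →
  Interleaved A B a b → ∀ c → F B (a , c) ≡ false → F A (b , c) ≡ true → ⊥
crossing-columns A B {a} {b} a<b agree (_ , Ba<Ab , _) c outB inA with adjacent-or-between a<b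
... | inj₁ b≡1+a = <⇒≱ Ba<Ab (begin
  vec A b                  ≤⟨ to (∈F⇔ A) inA ⟩
  toℕ b + toℕ c + 1        ≡⟨ cong (λ r → r + toℕ c + 1) b≡1+a ⟩
  suc (threshold (a , c))  ≤⟨ to (∉F⇔ B) outB ⟩
  vec B a                  ∎)
  where open ≤-Reasoning
... | inj₂ (l , a<l , l<b) = true≢false (begin
  true       ≡⟨ sym (F-up A (<⇒≤ l<b , ≤-refl) inA) ⟩
  F A (l , c) ≡⟨ agree⇒F≡ A B (agree l a<l l<b) ⟩
  F B (l , c) ≡⟨ F-down B (<⇒≤ a<l , ≤-refl) outB ⟩
  false      ∎)
  where open ≡-Reasoning

comparable-refl : ∀ {k n} (p : Cell k n) → Comparable p p
comparable-refl p = inj₁ (≤-refl , ≤-refl)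

same-row-comparable : ∀ {k n} (x : Fin k) (c c' : Fin (n ∸ k)) → Comparable {k} {n} (x , c) (x , c')
same-row-comparable x c c' with ≤-total (toℕ c) (toℕ c')
... | inj₁ c≤c' = inj₁ (≤-refl , c≤c')
... | inj₂ c'≤c = inj₂ (≤-refl , c'≤c)

path-head : ∀ {k n} {X : Subset k n} {p q} → Path X p q → X p ≡ true
path-head (here e)     = e
path-head (step e _ _) = e

no-path-across : ∀ {k n} {X : Subset k n} (Low High : Cell k n → Set) →
  (∀ {p} → X p ≡ true → Low p ⊎ High p) →
  (∀ {p q} → X p ≡ true → X q ≡ true → Low p → High q → ¬ Comparable p q) →
  ∀ {u w} → Path X u w → Low u → High w → ⊥
no-path-across Low High split sep {u} (here Xu) lu hu = sep Xu Xu lu hu (comparable-refl u)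
no-path-across Low High split sep (step Xp cmp rest) lp hw with split (path-head rest)
... | inj₁ lr = no-path-across Low High split sep rest lr hw
... | inj₂ hr = sep Xp (path-head rest) lp hr cmp

least : ∀ {m} (Q : Fin m → Set) → Decidable Q → ∀ {w} → Q w →
  Σ (Fin m) λ i → Q i × (∀ j → toℕ j < toℕ i → ¬ Q j)
least Q Q? {fzero} q = fzero , q , λ j ()
least Q Q? {fsuc w} q with Q? fzero
... | yes q₀ = fzero , q₀ , λ j ()
... | no ¬q₀ = let (i , qi , below) = least (Q ∘ fsuc) (Q? ∘ fsuc) q in
  fsuc i , qi , λ { fzero _ → ¬q₀ ; (fsuc j) j<i → below j (s≤s⁻¹ j<i) }

greatest : ∀ {m} (Q : Fin m → Set) → Decidable Q → ∀ {w} → Q w →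
  Σ (Fin m) λ i → Q i × (∀ j → toℕ i < toℕ j → ¬ Q j)
greatest {suc m} Q Q? {w} q with Fin.any? (Q? ∘ fsuc)
... | yes (w' , q') = let (i , qi , above) = greatest (Q ∘ fsuc) (Q? ∘ fsuc) q' in
  fsuc i , qi , λ { fzero () ; (fsuc j) i<j → above j (s≤s⁻¹ i<j) }
... | no none = fzero , subst Q (only-zero w q) q , λ { fzero () ; (fsuc j) _ qj → none (j , qj) }
  where
    only-zero : ∀ v → Q v → v ≡ fzero
    only-zero fzero    _  = refl
    only-zero (fsuc v) qv = ⊥-elim (none (v , qv))

Occupied : ∀ {k n} → Subset k n → Fin k → Set
Occupied X r = ∃ λ c → X (r , c) ≡ true

occupied? : ∀ {k n} (X : Subset k n) → Decidable (Occupied X)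
occupied? X r = Fin.any? (λ c → X (r , c) Bool.≟ true)

AdjacentDiffer : ∀ {d} → (Fin d → Bool) → Set
AdjacentDiffer α = ∀ x y → Adjacent x y → α x ≢ α y

alternates : ∀ {d} (α : Fin (suc d) → Bool) → AdjacentDiffer α → ∀ i → α i ≡ α fzero xor odd (toℕ i)
alternates α differ fzero = sym (Bool.xor-identityʳ _)
alternates {suc d} α differ (fsuc i) = begin
  α (fsuc i)                       ≡⟨ alternates (α ∘ fsuc) shifted i ⟩
  α (fsuc fzero) xor odd (toℕ i)   ≡⟨ cong (_xor odd (toℕ i)) (Bool.¬-not (differ fzero (fsuc fzero) refl ∘ sym)) ⟩
  not (α fzero) xor odd (toℕ i)    ≡⟨ sym (Bool.not-distribˡ-xor (α fzero) _) ⟩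
  not (α fzero xor odd (toℕ i))    ≡⟨ Bool.not-distribʳ-xor (α fzero) _ ⟩
  α fzero xor not (odd (toℕ i))    ∎
  where
    open ≡-Reasoning
    shifted : AdjacentDiffer (α ∘ fsuc)
    shifted x y adj = differ (fsuc x) (fsuc y) (cong suc adj)

adjacent-differ⇔alternating : ∀ {d} (α : Fin d → Bool) → AdjacentDiffer α ⇔ (IsAlt01 α ⊎ IsAlt10 α)
adjacent-differ⇔alternating α = mk⇔ alternating differ
  where
    alternating : ∀ {d} {α : Fin d → Bool} → AdjacentDiffer α → IsAlt01 α ⊎ IsAlt10 α
    alternating {zero} _ = inj₁ λ ()
    alternating {suc d} {α} adj with α fzero | alternates α adj
    ... | false | from-false = inj₁ from-false
    ... | true  | from-true  = inj₂ from-true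
    differ : IsAlt01 α ⊎ IsAlt10 α → AdjacentDiffer α
    differ (inj₁ alt) x y adj same =
      Bool.not-¬ refl (trans (sym (alt x)) (trans same (trans (alt y) (cong odd adj))))
    differ (inj₂ alt) x y adj same =
      Bool.not-¬ refl (trans (sym (alt x)) (trans same (trans (alt y) (cong (not ∘ odd) adj))))

pair-const⇔ : ∀ {d} {α β : Fin d → Bool} → (∀ i → β i ≡ not (α i)) →
  PairIsConst α β ⇔ (IsConst false α ⊎ IsConst false β)
pair-const⇔ {α = α} {β} β≡¬α = mk⇔ forget complete
  where
    forget : PairIsConst α β → IsConst false α ⊎ IsConst false β
    forget (inj₁ (α-false , _)) = inj₁ α-false
    forget (inj₂ (_ , β-false)) = inj₂ β-false
    complete : IsConst false α ⊎ IsConst false β → PairIsConst α β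
    complete (inj₁ α-false) = inj₁ (α-false , λ i → trans (β≡¬α i) (cong not (α-false i)))
    complete (inj₂ β-false) = inj₂ ((λ i → Bool.not-injective (trans (sym (β≡¬α i)) (β-false i))) , β-false)

pair-alt⇔ : ∀ {d} {α β : Fin d → Bool} → (∀ i → β i ≡ not (α i)) →
  PairIsAlt α β ⇔ (IsAlt01 α ⊎ IsAlt10 α)
pair-alt⇔ {α = α} {β} β≡¬α = mk⇔ forget complete
  where
    forget : PairIsAlt α β → IsAlt01 α ⊎ IsAlt10 α
    forget (inj₁ (alt , _)) = inj₁ alt
    forget (inj₂ (alt , _)) = inj₂ alt
    complete : IsAlt01 α ⊎ IsAlt10 α → PairIsAlt α β
    complete (inj₁ alt) = inj₁ (alt , λ i → trans (β≡¬α i) (cong not (alt i)))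
    complete (inj₂ alt) = inj₂ (alt , λ i → trans (β≡¬α i) (trans (cong not (alt i)) (Bool.not-involutive _)))

components-cong : ∀ {k n} {S S' : Subset k n} {d P} → (∀ p → S p ≡ S' p) →
  IsComponents S d P → IsComponents S' d P
components-cong S≡S' (nonempty , cover , disjoint , connected , separated) =
  nonempty , (λ p → mk⇔ (to (cover p) ∘ trans (S≡S' p)) (trans (sym (S≡S' p)) ∘ from (cover p)))
  , disjoint , connected , separated

decomposition-colours : ∀ {k n} (I J K : V k n) {d P α} → IsComponents (F I △ F J) d P →
  Decomposes I J K d P α → ∀ i p → P i p ≡ true → α i ≡ F K p
decomposition-colours I J K {d} {P} {α} comp decomposes i p p∈Pi = bit-injective (sym (begin
  bit (F K p)                                                   ≡⟨ decomposes p ⟩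
  bit ((F I ∩ F J) p) + sumFin d (λ j → bit (α j) * bit (P j p))
    ≡⟨ cong₂ _+_ (cong bit (xor-true⇒∧-false {F I p} {F J p} p∈S)) (sumFin-single _ i others) ⟩
  bit (α i) * bit (P i p)                                       ≡⟨ cong (λ b → bit (α i) * bit b) p∈Pi ⟩
  bit (α i) * 1                                                 ≡⟨ *-identityʳ _ ⟩
  bit (α i)                                                     ∎))
  where
    open ≡-Reasoning
    p∈S : (F I △ F J) p ≡ true
    p∈S = from (proj₁ (proj₂ comp) p) (i , p∈Pi)
    others : ∀ j → j ≢ i → bit (α j) * bit (P j p) ≡ 0
    others j j≢i = trans (cong (λ b → bit (α j) * bit b)
                               (Bool.¬-not λ p∈Pj → j≢i (proj₁ (proj₂ (proj₂ comp)) j i p p∈Pj p∈Pi)))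
                         (*-zeroʳ (bit (α j)))

module ColouredComponents {k n} (A B : V k n) {d} (P : Fin d → Subset k n)
  (comp : IsComponents (F A △ F B) d P) (lab : IsLabelled d P)
  (α : Fin d → Bool) (colour : ∀ i p → P i p ≡ true → α i ≡ F A p) where

  S : Subset k n
  S = F A △ F B

  nonempty : ∀ i → ∃ λ p → P i p ≡ true
  nonempty = proj₁ comp

  member⇒S : ∀ {i p} → P i p ≡ true → S p ≡ true
  member⇒S {i} {p} e = from (proj₁ (proj₂ comp) p) (i , e)

  component-of : ∀ {p} → S p ≡ true → ∃ λ i → P i p ≡ true
  component-of {p} = to (proj₁ (proj₂ comp) p)

  connected : ∀ i p q → P i p ≡ true → P i q ≡ true → Path (P i) p q
  connected = proj₁ (proj₂ (proj₂ (proj₂ comp)))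

  comparable⇒same : ∀ {i j p q} → P i p ≡ true → P j q ≡ true → Comparable p q → i ≡ j
  comparable⇒same {i} {j} {p} {q} ep eq cmp with i Fin.≟ j
  ... | yes i≡j = i≡j
  ... | no  i≢j = contradiction cmp (proj₂ (proj₂ (proj₂ (proj₂ comp))) i j p q i≢j ep eq)

  -- The labelling puts later components in strictly lower rows (a row is a chain).
  labelled-rows : ∀ {i j p q} → toℕ i < toℕ j → P i p ≡ true → P j q ≡ true → toℕ (proj₁ p) < toℕ (proj₁ q)
  labelled-rows {i} {j} {a , b} {a' , b'} i<j ep eq = ≤∧≢⇒< (proj₁ (lab i j a b a' b' i<j ep eq)) different
    where
      different : toℕ a ≢ toℕ a'
      different a≡a' with Fin.toℕ-injective a≡a'
      ... | refl = <-irrefl (cong toℕ (comparable⇒same ep eq (same-row-comparable a b b'))) i<j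

  colour-true⇒Diff : ∀ {i p} → α i ≡ true → P i p ≡ true → Diff A B p
  colour-true⇒Diff {i} {p} t e with to (△⇔Diff A B) (member⇒S e)
  ... | inj₁ diff       = diff
  ... | inj₂ (_ , outA) = ⊥-elim (true≢false (trans (sym t) (trans (colour i p e) outA)))

  Diff⇒colour-true : ∀ {i p} → P i p ≡ true → Diff A B p → α i ≡ true
  Diff⇒colour-true {i} {p} e (inA , _) = trans (colour i p e) inA

  uncoloured⇔dominated : IsConst false α ⇔ Dominated A B
  uncoloured⇔dominated = mk⇔ dominated uncoloured
    where
      dominated : IsConst false α → Dominated A B
      dominated none x A<B =
        let (_ , _ , diff) = row<⇒Diff A B x A<B
            (i , e) = component-of (from (△⇔Diff A B) (inj₁ diff))
        in true≢false (trans (sym (Diff⇒colour-true e diff)) (none i))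
      uncoloured : Dominated A B → IsConst false α
      uncoloured dom i = Bool.¬-not λ t →
        let ((x , _) , e) = nonempty i in dom x (Diff⇒row< A B (colour-true⇒Diff t e))

  -- Part (2), from crossings to components.  Cells of S in rows ≤ a and in rows ≥ b of a
  -- crossing are incomparable: a comparability would put a column c with (a,c) ∉ F_B and
  -- (b,c) ∈ F_A.
  crossing-separates : ∀ {a b} → toℕ a < toℕ b → Agree A B a b → Interleaved A B a b →
    ∀ {u w} → S u ≡ true → S w ≡ true → toℕ (proj₁ u) ≤ toℕ a → toℕ b ≤ toℕ (proj₁ w) → ¬ Comparable u w
  crossing-separates a<b _ _ {r , _} {r' , _} _ _ r≤a b≤r' (inj₁ (r'≤r , _)) =
    <⇒≱ a<b (≤-trans b≤r' (≤-trans r'≤r r≤a))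
  crossing-separates {a} {b} a<b agree il@(Aa<Ba , _ , Ab<Bb) {r , c} {r' , c'} u∈S w∈S r≤a b≤r' (inj₂ (_ , c'≤c)) =
    crossing-columns A B a<b agree il c outB inA
    where
      outB : F B (a , c) ≡ false
      outB with to (△⇔Diff A B) u∈S
      ... | inj₁ (_ , u∉B) = F-down B (r≤a , ≤-refl) u∉B
      ... | inj₂ (_ , u∉A) = F-antitone-false A B (<⇒≤ Aa<Ba) (F-down A (r≤a , ≤-refl) u∉A)
      inA : F A (b , c) ≡ true
      inA with to (△⇔Diff A B) w∈S
      ... | inj₁ (w∈A , _) = F-up A (b≤r' , c'≤c) w∈A
      ... | inj₂ (w∈B , _) = F-antitone B A (<⇒≤ Ab<Bb) (F-up B (b≤r' , c'≤c) w∈B)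

  crossing-components : ∀ {a b} → toℕ a < toℕ b → Agree A B a b → Interleaved A B a b →
    ∀ {ca cb i j} → P i (a , ca) ≡ true → P j (b , cb) ≡ true → Adjacent i j
  crossing-components {a} {b} a<b agree il {i = i} {j} ei ej with <-cmp (toℕ i) (toℕ j)
  ... | tri> _ _ j<i = ⊥-elim (<-asym a<b (labelled-rows j<i ej ei))
  ... | tri≈ _ i≡j _ rewrite Fin.toℕ-injective i≡j =
    ⊥-elim (no-path-across Low High outside apart (connected j _ _ ei ej) ≤-refl ≤-refl)
    where
      Low High : Cell k n → Set
      Low  u = toℕ (proj₁ u) ≤ toℕ a
      High u = toℕ b ≤ toℕ (proj₁ u)
      outside : ∀ {u} → P j u ≡ true → Low u ⊎ High u
      outside {l , c} e with toℕ l ≤? toℕ a | toℕ b ≤? toℕ l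
      ... | yes l≤a | _       = inj₁ l≤a
      ... | no _    | yes b≤l = inj₂ b≤l
      ... | no l≰a  | no l≱b  = ⊥-elim (agree⇒row-empty A B (agree l (≰⇒> l≰a) (≰⇒> l≱b)) (member⇒S e))
      apart : ∀ {u w} → P j u ≡ true → P j w ≡ true → Low u → High w → ¬ Comparable u w
      apart eu ew = crossing-separates a<b agree il (member⇒S eu) (member⇒S ew)
  ... | tri< i<j _ _ with adjacent-or-between i<j
  ...   | inj₁ adj = adj
  ...   | inj₂ (z , i<z , z<j) =
    let (pz , ez) = nonempty z
        a<row = labelled-rows i<z ei ez
        row<b = labelled-rows z<j ez ej
    in ⊥-elim (agree⇒row-empty A B (agree (proj₁ pz) a<row row<b) (member⇒S ez))

  crossing⇒adjacent-true : ∀ {a b} → toℕ a < toℕ b → Agree A B a b → Interleaved A B a b →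
    ∃₂ λ x y → Adjacent x y × α x ≡ true × α y ≡ true
  crossing⇒adjacent-true {a} {b} a<b agree il@(Aa<Ba , _ , Ab<Bb) =
    let (_ , _ , diff-a) = row<⇒Diff A B a Aa<Ba
        (_ , _ , diff-b) = row<⇒Diff A B b Ab<Bb
        (x , ex) = component-of (from (△⇔Diff A B) (inj₁ diff-a))
        (y , ey) = component-of (from (△⇔Diff A B) (inj₁ diff-b))
    in x , y , crossing-components a<b agree il ex ey , Diff⇒colour-true ex diff-a , Diff⇒colour-true ey diff-b

  -- Rows r < r' meeting F_A \ F_B in components
  -- i and j with A_{r'} ≤ B_r are linked: the leftmost F_A-cell w of row r' and the cell u
  -- above it are in F_A \ F_B, u is in the row of P_i and w in the row of P_j.
  linked-rows : ∀ {i j r c r' c'} → toℕ r < toℕ r' → P i (r , c) ≡ true → P j (r' , c') ≡ true →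
    Diff A B (r' , c') → vec A r' ≤ vec B r → i ≡ j
  linked-rows {i} {j} {r} {c} {r'} {c'} r<r' ei ej diff' A'≤B =
    let (col , on-entry , diff-w) = row<⇒Diff A B r' (Diff⇒row< A B diff')
        u-in-A = F-up A (<⇒≤ r<r' , ≤-refl) (proj₁ diff-w)
        u-out-B = from (∉F⇔ B) (begin-strict
          toℕ r + toℕ col + 1   <⟨ +-monoˡ-< 1 (+-monoˡ-< (toℕ col) r<r') ⟩
          toℕ r' + toℕ col + 1  ≡⟨ on-entry ⟩
          vec A r'              ≤⟨ A'≤B ⟩
          vec B r               ∎)
        (iu , eu) = component-of (from (△⇔Diff A B) (inj₁ (u-in-A , u-out-B)))
        (iw , ew) = component-of (from (△⇔Diff A B) (inj₁ diff-w))
    in trans (comparable⇒same ei eu (same-row-comparable r c col))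
             (trans (comparable⇒same eu ew (inj₂ (<⇒≤ r<r' , ≤-refl)))
                    (comparable⇒same ew ej (same-row-comparable r' col c')))
    where open ≤-Reasoning

  gap-rows-agree : ∀ {x y x₁ c₁ x₂ c₂} → Adjacent x y → P x (x₁ , c₁) ≡ true → P y (x₂ , c₂) ≡ true →
    (∀ r → toℕ x₁ < toℕ r → ¬ Occupied (P x) r) → (∀ r → toℕ r < toℕ x₂ → ¬ Occupied (P y) r) →
    Agree A B x₁ x₂
  gap-rows-agree {x} adj e₁ e₂ last first l x₁<l l<x₂ =
    row-empty⇒agree A B l λ c e → empty c (component-of e)
    where
      empty : ∀ c → ∃ (λ z → P z (l , c) ≡ true) → ⊥
      empty c (z , ez) with <-cmp (toℕ z) (toℕ x)
      ... | tri< z<x _ _ = <-asym x₁<l (labelled-rows z<x ez e₁)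
      ... | tri≈ _ z≡x _ = last l x₁<l (c , subst (λ i → P i (l , c) ≡ true) (Fin.toℕ-injective z≡x) ez)
      ... | tri> _ _ x<z with m≤n⇒m<n∨m≡n (subst (_≤ toℕ z) (sym adj) x<z)
      ...   | inj₁ y<z = <-asym l<x₂ (labelled-rows y<z e₂ ez)
      ...   | inj₂ y≡z = first l l<x₂ (c , subst (λ i → P i (l , c) ≡ true) (Fin.toℕ-injective (sym y≡z)) ez)

  -- Adjacent components both coloured true yield a crossing between the last row of P_x
  -- and the first row of P_{x+1}.
  adjacent-true⇒crossing : ∀ {x y} → Adjacent x y → α x ≡ true → α y ≡ true →
    ∃₂ λ a b → toℕ a < toℕ b × Agree A B a b × Interleaved A B a b
  adjacent-true⇒crossing {x} {y} adj tx ty =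
    let ((_ , c) , ex) = nonempty x
        ((_ , c') , ey) = nonempty y
        (x₁ , (c₁ , e₁) , last)  = greatest (Occupied (P x)) (occupied? (P x)) (c , ex)
        (x₂ , (c₂ , e₂) , first) = least (Occupied (P y)) (occupied? (P y)) (c' , ey)
        x₁<x₂ = labelled-rows (adjacent⇒< adj) e₁ e₂
        diff₁ = colour-true⇒Diff tx e₁
        diff₂ = colour-true⇒Diff ty e₂
        B₁<A₂ = ≰⇒> λ A₂≤B₁ → adjacent⇒≢ adj (linked-rows x₁<x₂ e₁ e₂ diff₂ A₂≤B₁)
    in x₁ , x₂ , x₁<x₂ , gap-rows-agree adj e₁ e₂ last first
       , Diff⇒row< A B diff₁ , B₁<A₂ , Diff⇒row< A B diff₂

module TwoColourings {k n} (I J : V k n) {d} (P : Fin d → Subset k n)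
  (comp : IsComponents (F I △ F J) d P) (lab : IsLabelled d P)
  (αI αJ : Fin d → Bool) (DI : Decomposes I J I d P αI) (DJ : Decomposes I J J d P αJ) where

  colour-I : ∀ i p → P i p ≡ true → αI i ≡ F I p
  colour-I = decomposition-colours I J I {α = αI} comp DI

  colour-J : ∀ i p → P i p ≡ true → αJ i ≡ F J p
  colour-J = decomposition-colours I J J {α = αJ} comp DJ

  module IJ = ColouredComponents I J P comp lab αI colour-I
  module JI = ColouredComponents J I P (components-cong (λ p → Bool.xor-comm (F I p) (F J p)) comp)
                                 lab αJ colour-J

  -- α_J is the complement of α_I: compare both on a cell of P_i.
  complementary : ∀ i → αJ i ≡ not (αI i)
  complementary i =
    let (p , e) = IJ.nonempty i in
    trans (colour-J i p e) (trans (xor-true⇒≡not {F I p} {F J p} (IJ.member⇒S e)) (cong not (sym (colour-I i p e))))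

  noncrossing⇔adjacent-differ : Noncrossing I J ⇔ AdjacentDiffer αI
  noncrossing⇔adjacent-differ = mk⇔ differ noncrossing
    where
      differ : Noncrossing I J → AdjacentDiffer αI
      differ nc x y adj same with αI x in αx
      ... | true = let (a , b , a<b , agree , il) = IJ.adjacent-true⇒crossing adj αx (sym same) in
                   nc a b a<b agree (inj₁ il)
      ... | false =
        let αJx = trans (complementary x) (cong not αx)
            αJy = trans (complementary y) (cong not (sym same))
            (a , b , a<b , agree , il) = JI.adjacent-true⇒crossing adj αJx αJy
        in nc a b a<b (λ l a<l l<b → sym (agree l a<l l<b)) (inj₂ il)
      noncrossing : AdjacentDiffer αI → Noncrossing I J
      noncrossing differ a b a<b agree (inj₁ il) =
        let (x , y , adj , tx , ty) = IJ.crossing⇒adjacent-true a<b agree il in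
        differ x y adj (trans tx (sym ty))
      noncrossing differ a b a<b agree (inj₂ il) =
        let (x , y , adj , tx , ty) = JI.crossing⇒adjacent-true a<b (λ l a<l l<b → sym (agree l a<l l<b)) il in
        differ x y adj (Bool.not-injective (trans (sym (complementary x)) (trans tx (trans (sym ty) (complementary y)))))

lemma4p13 : (k n : ℕ) → 1 ≤ k → k < n → (I J : V k n) →
    (d : ℕ) → (P : Fin d → Subset k n) →
    IsComponents (F I △ F J) d P → IsLabelled d P →
    (αI αJ : Fin d → Bool) → Decomposes I J I d P αI → Decomposes I J J d P αJ →
    ((Nonnesting I J ⇔ PairIsConst αI αJ) × (Noncrossing I J ⇔ PairIsAlt αI αJ))
lemma4p13 k n _ _ I J d P comp lab αI αJ DI DJ = nesting , crossing
  where
    open TwoColourings I J P comp lab αI αJ DI DJ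

    nesting : Nonnesting I J ⇔ PairIsConst αI αJ
    nesting = ⇔.trans (nonnesting⇔ordered I J)
             (⇔.trans (⇔-sym IJ.uncoloured⇔dominated ⊎-⇔ ⇔-sym JI.uncoloured⇔dominated)
                      (⇔-sym (pair-const⇔ complementary)))

    crossing : Noncrossing I J ⇔ PairIsAlt αI αJ
    crossing = ⇔.trans noncrossing⇔adjacent-differ
              (⇔.trans (adjacent-differ⇔alternating αI) (⇔-sym (pair-alt⇔ complementary)))
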